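{- Let $X=X_1\sqcup X_2$ carry a coherent configuration $\{\sigma_1,\dots,\sigma_{10}\}$ of type $[3\ 2;\ 3]$ with parameters as in the context, and let the nontrivial eigenvalues $r_1,s_1$ of $\sigma_2$ and $r_2,s_2$ of $\sigma_5$ be labeled as in the context. Then (13) $S_1+a_1k_2+b_1\ell_2=S_2+a_2k_1+b_2\ell_1=S_1S_2$; (14) $S_1+a_1r_2-b_1(r_2+1)=S_2+a_2r_1-b_2(r_1+1)$; (15) $S_1+a_1s_2-b_1(s_2+1)=S_2+a_2s_1-b_2(s_1+1)=0$.
   Context: A coherent configuration on a finite set $X$ is a partition of $X\times X$ into nonempty relations $\sigma_1,\dots,\sigma_m$ such that the diagonal is a union of some $\sigma_i$, the transpose of each $\sigma_i$ is some $\sigma_{i^*}$, and for all $i,j,k$ and $(x,z)\in\sigma_k$ the number $|\{y:(x,y)\in\sigma_i,(y,z)\in\sigma_j\}|$ depends only on $i,j,k$. Relations are identified with their $0/1$ adjacency matrices; the adjacency algebra is $A=\mathrm{span}_{\mathbb C}\{\sigma_1,\dots,\sigma_{10}\}$, a semisimple algebra. Type $[3\ 2;\ 3]$ means: $X=X_1\sqcup X_2$, $|X_i|=n_i$; $\sigma_1$ is the identity on $X_1$, $\sigma_2,\sigma_3$ are symmetric relations partitioning the off-diagonal pairs of $X_1\times X_1$, with $\sigma_2$ a strongly regular graph with parameters $(n_1,k_1,\lambda_1,\mu_1)$ and $\sigma_3$ its complement; $\sigma_4$ is the identity on $X_2$, $\sigma_5$ is a strongly regular graph on $X_2$ with parameters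 $(n_2,k_2,\lambda_2,\mu_2)$, $\sigma_6$ its complement; $\sigma_7,\sigma_8$ partition $X_1\times X_2$, $\sigma_9=\sigma_7^T$, $\sigma_{10}=\sigma_8^T$. Put $\ell_i=n_i-k_i-1$. $S_2$ = number of $z\in X_2$ with $(x,z)\in\sigma_7$ for $x\in X_1$; $S_1$ = number of $x\in X_1$ with $(x,z)\in\sigma_7$ for $z\in X_2$. For distinct $x,y\in X_1$, the number of $z\in X_2$ with $(x,z),(y,z)\in\sigma_7$ is $a_2$ if $(x,y)\in\sigma_2$ and $b_2$ if $(x,y)\in\sigma_3$. For distinct $z,w\in X_2$, the number of $x\in X_1$ with $(x,z),(x,w)\in\sigma_7$ is $a_1$ if $(z,w)\in\sigma_5$ and $b_1$ if $(z,w)\in\sigma_6$. Eigenvalue labeling: the eigenvalues of $\sigma_2$ on $\mathbb C^{X_1}$ other than $k_1$ are $r_1,s_1$ (multiplicities $f_1,g_1$), and those of $\sigma_5$ on $\mathbb C^{X_2}$ other than $k_2$ are $r_2,s_2$ (multiplicities $f_2,g_2$), labeled so that $f_1=f_2$ and $A$ has an irreducible character $\varphi$ with $\varphi(\sigma_1)=\varphi(\sigma_4)=1$, $\varphi(\sigma_2)=r_1$, $\varphi(\sigma_3)=-1-r_1$, $\varphi(\sigma_5)=r_2$, $\varphi(\sigma_6)=-1-r_2$, while $A$ has irreducible characters $\psi_1,\psi_2$ with $\psi_1(\sigma_1)=1,\psi_1(\sigma_2)=s_1,\psi_1(\sigma_3)=-1-s_1$ and $\psi_1(\sigma_4)=\psi_1(\sigma_5)=\psi_1(\sigma_6)=0$,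 and $\psi_2(\sigma_4)=1,\psi_2(\sigma_5)=s_2,\psi_2(\sigma_6)=-1-s_2$ and $\psi_2(\sigma_1)=\psi_2(\sigma_2)=\psi_2(\sigma_3)=0$. -}

module Defs where

open import Level using (Level; _⊔_) renaming (suc to lsuc)
open import Function using (_∘_)
open import Data.Nat as ℕ using (ℕ; zero; suc)
open import Data.Fin using (Fin; zero; suc; #_; _≟_)
open import Data.Bool using (Bool; true; false; _∧_; if_then_else_)
open import Data.Sum using (_⊎_; inj₁; inj₂)
open import Data.Product using (Σ; ∃; ∃-syntax; _×_; _,_)
open import Data.List using (List; []; _∷_; length)
open import Relation.Nullary using (¬_)
open import Relation.Nullary.Decidable using (⌊_⌋)
open import Relation.Binary.PropositionalEquality using (_≡_; _≢_)
open import Algebra.Bundles using (CommutativeRing)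

countFin : ∀ {n} → (Fin n → Bool) → ℕ
countFin {zero}  f = 0
countFin {suc n} f = (if f zero then 1 else 0) ℕ.+ countFin (f ∘ suc)

Point : ℕ → ℕ → Set
Point n₁ n₂ = Fin n₁ ⊎ Fin n₂

countX : ∀ {n₁ n₂} → (Point n₁ n₂ → Bool) → ℕ
countX f = countFin (f ∘ inj₁) ℕ.+ countFin (f ∘ inj₂)

-- Relation indices: σᵢ is index i-1 in Fin 10

Idx : Set
Idx = Fin 10

σ₁ σ₂ σ₃ σ₄ σ₅ σ₆ σ₇ σ₈ σ₉ σ₁₀ : Idx
σ₁ = # 0
σ₂ = # 1
σ₃ = # 2
σ₄ = # 3
σ₅ = # 4
σ₆ = # 5
σ₇ = # 6
σ₈ = # 7
σ₉ = # 8
σ₁₀ = # 9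

_==_ : Idx → Idx → Bool
i == j = ⌊ i ≟ j ⌋

-- Coherent configuration with 10 relations on X.
-- A colouring col : X → X → Idx, (x,y) ∈ σᵢ  iff  col x y ≡ i;
-- this is exactly a partition of X × X into the relations σ₁,…,σ₁₀.

record IsCoherentConfiguration {n₁ n₂ : ℕ} (col : Point n₁ n₂ → Point n₁ n₂ → Idx) : Set where
  field
    nonempty     : ∀ i → ∃[ x ] ∃[ y ] col x y ≡ i
    -- the diagonal is a union of some of the σᵢ
    diagonal     : ∀ i → (∀ x y → col x y ≡ i → x ≡ y) ⊎ (∀ x → col x x ≢ i)
    transpose    : Σ (Idx → Idx) λ star → (∀ x y → col y x ≡ star (col x y))
    p            : Idx → Idx → Idx → ℕ
    intersection : ∀ i j k x z → col x z ≡ k →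
                   countX (λ y → (col x y == i) ∧ (col y z == j)) ≡ p i j k

record IsType323 {n₁ n₂ : ℕ} (col : Point n₁ n₂ → Point n₁ n₂ → Idx) : Set where
  field
    diag₁ : ∀ a → col (inj₁ a) (inj₁ a) ≡ σ₁
    off₁  : ∀ a b → a ≢ b → col (inj₁ a) (inj₁ b) ≡ σ₂ ⊎ col (inj₁ a) (inj₁ b) ≡ σ₃
    sym₁  : ∀ a b → col (inj₁ a) (inj₁ b) ≡ col (inj₁ b) (inj₁ a)
    diag₂ : ∀ z → col (inj₂ z) (inj₂ z) ≡ σ₄
    off₂  : ∀ z w → z ≢ w → col (inj₂ z) (inj₂ w) ≡ σ₅ ⊎ col (inj₂ z) (inj₂ w) ≡ σ₆
    sym₂  : ∀ z w → col (inj₂ z) (inj₂ w) ≡ col (inj₂ w) (inj₂ z)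
    mixed : ∀ a z → (col (inj₁ a) (inj₂ z) ≡ σ₇ × col (inj₂ z) (inj₁ a) ≡ σ₉)
                  ⊎ (col (inj₁ a) (inj₂ z) ≡ σ₈ × col (inj₂ z) (inj₁ a) ≡ σ₁₀)

adj₁ : ∀ {n₁ n₂} → (Point n₁ n₂ → Point n₁ n₂ → Idx) → Idx → Fin n₁ → Fin n₁ → Bool
adj₁ col i a b = col (inj₁ a) (inj₁ b) == i

adj₂ : ∀ {n₁ n₂} → (Point n₁ n₂ → Point n₁ n₂ → Idx) → Idx → Fin n₂ → Fin n₂ → Bool
adj₂ col i z w = col (inj₂ z) (inj₂ w) == i

in₇ : ∀ {n₁ n₂} → (Point n₁ n₂ → Point n₁ n₂ → Idx) → Fin n₁ → Fin n₂ → Bool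
in₇ col a z = col (inj₁ a) (inj₂ z) == σ₇

record IsSRG (n k lam mu : ℕ) (adj : Fin n → Fin n → Bool) : Set where
  field
    irrefl       : ∀ a → adj a a ≡ false
    symmetric    : ∀ a b → adj a b ≡ adj b a
    regular      : ∀ a → countFin (adj a) ≡ k
    adjCommon    : ∀ a b → adj a b ≡ true → countFin (λ z → adj a z ∧ adj z b) ≡ lam
    nonadjCommon : ∀ a b → a ≢ b → adj a b ≡ false → countFin (λ z → adj a z ∧ adj z b) ≡ mu

record HasParams {n₁ n₂ : ℕ} (col : Point n₁ n₂ → Point n₁ n₂ → Idx)
                 (S₁ S₂ a₁ b₁ a₂ b₂ : ℕ) : Set where
  field
    S₂-def : ∀ x → countFin (λ z → in₇ col x z) ≡ S₂
    S₁-def : ∀ z → countFin (λ x → in₇ col x z) ≡ S₁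
    a₂-def : ∀ x y → col (inj₁ x) (inj₁ y) ≡ σ₂ → countFin (λ z → in₇ col x z ∧ in₇ col y z) ≡ a₂
    b₂-def : ∀ x y → col (inj₁ x) (inj₁ y) ≡ σ₃ → countFin (λ z → in₇ col x z ∧ in₇ col y z) ≡ b₂
    a₁-def : ∀ z w → col (inj₂ z) (inj₂ w) ≡ σ₅ → countFin (λ x → in₇ col x z ∧ in₇ col x w) ≡ a₁
    b₁-def : ∀ z w → col (inj₂ z) (inj₂ w) ≡ σ₆ → countFin (λ x → in₇ col x z ∧ in₇ col x w) ≡ b₁

-- Linear algebra over a commutative ring K (used with K a field of
-- characteristic 0 that is algebraically closed, standing in for ℂ)

module LinAlg {c ℓ : Level} (R : CommutativeRing c ℓ) where
  open CommutativeRing R renaming (Carrier to K) hiding (zero)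

  IsField : Set (c ⊔ ℓ)
  IsField = (0# ≉ 1#) × (∀ x → x ≉ 0# → ∃[ y ] (x * y ≈ 1#))

  ι : ℕ → K
  ι zero    = 0#
  ι (suc n) = 1# + ι n

  CharZero : Set ℓ
  CharZero = ∀ n → ι (suc n) ≉ 0#

  -- monic polynomial  a₀ + a₁ x + … + a_{m-1} x^{m-1} + x^m  with coefficient list [a₀, …, a_{m-1}]
  evalMonic : List K → K → K
  evalMonic []       x = 1#
  evalMonic (a ∷ as) x = a + x * evalMonic as x

  AlgClosed : Set (c ⊔ ℓ)
  AlgClosed = ∀ (as : List K) → 1 ℕ.≤ length as → ∃[ x ] (evalMonic as x ≈ 0#)

  bool : Bool → K
  bool true  = 1#
  bool false = 0#

  sum : ∀ {n} → (Fin n → K) → K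
  sum {zero}  f = 0#
  sum {suc n} f = f zero + sum (f ∘ suc)

  Vec : ℕ → Set c
  Vec n = Fin n → K

  Mat : ℕ → Set c
  Mat n = Fin n → Fin n → K

  0ᵥ : ∀ {n} → Vec n
  0ᵥ i = 0#

  _≈ᵥ_ : ∀ {n} → Vec n → Vec n → Set ℓ
  v ≈ᵥ w = ∀ i → v i ≈ w i

  _≈ₘ_ : ∀ {n} → Mat n → Mat n → Set ℓ
  M ≈ₘ N = ∀ i j → M i j ≈ N i j

  _·ᵥ_ : ∀ {n} → Mat n → Vec n → Vec n
  (M ·ᵥ v) i = sum (λ j → M i j * v j)

  _⊗_ : ∀ {n} → Mat n → Mat n → Mat n
  (M ⊗ N) i j = sum (λ k → M i k * N k j)

  _+ₘ_ : ∀ {n} → Mat n → Mat n → Mat n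
  (M +ₘ N) i j = M i j + N i j

  Iₘ : ∀ {n} → Mat n
  Iₘ i j = bool ⌊ i ≟ j ⌋

  trace : ∀ {n} → Mat n → K
  trace M = sum (λ i → M i i)

  IsEigenvalue : ∀ {n} → Mat n → K → Set (c ⊔ ℓ)
  IsEigenvalue M t = ∃[ v ] (¬ (v ≈ᵥ 0ᵥ) × (M ·ᵥ v) ≈ᵥ (λ i → t * v i))

  LinIndep : ∀ {n m} → (Fin m → Vec n) → Set (c ⊔ ℓ)
  LinIndep vs = ∀ (α : Fin _ → K) → (λ i → sum (λ j → α j * vs j i)) ≈ᵥ 0ᵥ → ∀ j → α j ≈ 0#

  HasIndepEigenvectors : ∀ {n} → Mat n → K → ℕ → Set (c ⊔ ℓ)
  HasIndepEigenvectors {n} M t m =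
    ∃[ vs ] (LinIndep {n} {m} vs × ∀ j → (M ·ᵥ vs j) ≈ᵥ (λ i → t * vs j i))

  -- t has multiplicity f as an eigenvalue of M (dimension of the eigenspace;
  -- M symmetric, hence diagonalizable in the situation considered)
  Multiplicity : ∀ {n} → Mat n → K → ℕ → Set (c ⊔ ℓ)
  Multiplicity M t f = HasIndepEigenvectors M t f × ¬ HasIndepEigenvectors M t (suc f)

  record SRGEigenvalues {n : ℕ} (M : Mat n) (k r s : K) (f g : ℕ) : Set (c ⊔ ℓ) where
    field
      r-eig  : IsEigenvalue M r
      s-eig  : IsEigenvalue M s
      r≉k    : r ≉ k
      s≉k    : s ≉ k
      r≉s    : r ≉ s
      only   : ∀ t → IsEigenvalue M t → t ≈ k ⊎ t ≈ r ⊎ t ≈ s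
      mult-r : Multiplicity M r f
      mult-s : Multiplicity M s g

  matOf : ∀ {n} → (Fin n → Fin n → Bool) → Mat n
  matOf adj a b = bool (adj a b)

  -- Representations of the adjacency algebra A = span{σ₁,…,σ₁₀}:
  -- a linear map A → Mat d is determined by the images ρ i of the basis σᵢ;
  -- it is a unital algebra homomorphism iff
  --   ρ i ⊗ ρ j ≈ Σ_k p i j k · ρ k   (σᵢσⱼ = Σ_k p_{ij}^k σ_k)   and
  --   ρ σ₁ + ρ σ₄ ≈ I                  (σ₁ + σ₄ is the identity of A).
  module _ {n₁ n₂ : ℕ} {col : Point n₁ n₂ → Point n₁ n₂ → Idx}
           (cc : IsCoherentConfiguration col) where
    open IsCoherentConfiguration cc using (p)

    IsRepresentation : ∀ {d} → (Idx → Mat d) → Set ℓ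
    IsRepresentation ρ =
      (∀ i j → (ρ i ⊗ ρ j) ≈ₘ (λ x y → sum (λ k → ι (p i j k) * ρ k x y)))
      × ((ρ σ₁ +ₘ ρ σ₄) ≈ₘ Iₘ)

    IsSubspace : ∀ {d} → (Vec d → Set (c ⊔ ℓ)) → Set (c ⊔ ℓ)
    IsSubspace W = W 0ᵥ × (∀ v w → W v → W w → W (λ i → v i + w i))
                 × (∀ a v → W v → W (λ i → a * v i)) × (∀ v w → v ≈ᵥ w → W v → W w)

    Invariant : ∀ {d} → (Idx → Mat d) → (Vec d → Set (c ⊔ ℓ)) → Set (c ⊔ ℓ)
    Invariant ρ W = ∀ i v → W v → W (ρ i ·ᵥ v)

    IsIrreducible : ∀ {d} → (Idx → Mat d) → Set (lsuc (c ⊔ ℓ))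
    IsIrreducible ρ = ∀ W → IsSubspace W → Invariant ρ W →
                      (∀ v → W v → v ≈ᵥ 0ᵥ) ⊎ (∀ v → W v)

    IsIrreducibleCharacter : (Idx → K) → Set (lsuc (c ⊔ ℓ))
    IsIrreducibleCharacter χ =
      ∃[ d ] Σ (Idx → Mat (suc d)) λ ρ →
        IsRepresentation ρ × IsIrreducible ρ × (∀ i → χ i ≈ trace (ρ i))

-- (13) is double counting: for a fixed z ∈ X₂ the pairs (x, w) with x σ₇ z and x σ₇ w number S₂S₁
-- when grouped by x, and S₁ + a₁k₂ + b₁ℓ₂ when grouped by w (w = z, w σ₅ z or w σ₆ z); likewise in X₁.
-- For (14) and (15), the intersection numbers give σ₇σ₉ = S₂σ₁ + a₂σ₂ + b₂σ₃ and σ₉σ₇ = S₁σ₄ + a₁σ₅ + b₁σ₆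
-- in the adjacency algebra. A character is the trace of a representation, so χ(σ₇σ₉) = χ(σ₉σ₇); evaluated
-- at φ this is (14), and at ψ₁ and ψ₂, which vanish on σ₄, σ₅, σ₆ resp. σ₁, σ₂, σ₃, it gives (15).
module Submission where

open import Defs
open import Level using (Level)
open import Data.Nat as ℕ using (ℕ; _∸_)
open import Data.Product using (∃-syntax; _×_; _,_)
open import Relation.Binary.PropositionalEquality using (_≡_)
open import Algebra.Bundles using (CommutativeRing)

module Counting where
  open import Function using (_∘_)
  open import Data.Nat using (zero; suc; _+_; _*_)
  open import Data.Nat.Properties using (+-*-semiring; +-identityʳ; +-assoc; +-comm; +-suc; *-zeroʳ; m+n∸m≡n; ∸-+-assoc)
  open import Data.Nat.Tactic.RingSolver using (solve-∀)
  open import Data.Fin using (Fin; zero; suc; punchIn)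
  open import Data.Fin.Properties using (punchInᵢ≢i)
  open import Data.Bool using (Bool; true; false; not; _∧_; if_then_else_)
  open import Data.Bool.Properties using (∧-idem)
  open import Relation.Binary.PropositionalEquality
  open import Algebra.Properties.Semiring.Sum +-*-semiring using (sum; sum-cong-≗; sum-remove; ∑-comm)

  indicator : Bool → ℕ
  indicator b = if b then 1 else 0

  countFin≡sum : ∀ {n} (p : Fin n → Bool) → countFin p ≡ sum (indicator ∘ p)
  countFin≡sum {zero}  p = refl
  countFin≡sum {suc n} p = cong (indicator (p zero) +_) (countFin≡sum (p ∘ suc))

  countFin-cong : ∀ {n} {p q : Fin n → Bool} → (∀ i → p i ≡ q i) → countFin p ≡ countFin q
  countFin-cong {zero}  p≗q = refl
  countFin-cong {suc n} p≗q = cong₂ _+_ (cong indicator (p≗q zero)) (countFin-cong (p≗q ∘ suc))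

  countFin-false : ∀ {n} {p : Fin n → Bool} → (∀ i → p i ≡ false) → countFin p ≡ 0
  countFin-false {zero}  p≗false = refl
  countFin-false {suc n} p≗false rewrite p≗false zero = countFin-false (p≗false ∘ suc)

  countFin-∧ : ∀ {n} b (p : Fin n → Bool) → countFin (λ i → b ∧ p i) ≡ (if b then countFin p else 0)
  countFin-∧ true  p = refl
  countFin-∧ {n} false p = countFin-false {n} (λ _ → refl)

  countFin+countFin-not : ∀ {n} (p : Fin n → Bool) → countFin p + countFin (not ∘ p) ≡ n
  countFin+countFin-not {zero}  p = refl
  countFin+countFin-not {suc n} p with p zero | countFin+countFin-not (p ∘ suc)
  ... | true  | ih = cong suc ih
  ... | false | ih = trans (+-suc _ _) (cong suc ih)

  sum-if : ∀ {n} (p : Fin n → Bool) (a b : ℕ) →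
           sum (λ i → if p i then a else b) ≡ a * countFin p + b * countFin (not ∘ p)
  sum-if {zero}  p a b = sym (cong₂ _+_ (*-zeroʳ a) (*-zeroʳ b))
  sum-if {suc n} p a b with p zero | sum-if (p ∘ suc) a b
  ... | true  | ih = trans (cong (a +_) ih) (take-a a b (countFin (p ∘ suc)) (countFin (not ∘ p ∘ suc)))
    where take-a : ∀ a b c d → a + (a * c + b * d) ≡ a * suc c + b * d
          take-a = solve-∀
  ... | false | ih = trans (cong (b +_) ih) (take-b a b (countFin (p ∘ suc)) (countFin (not ∘ p ∘ suc)))
    where take-b : ∀ a b c d → b + (a * c + b * d) ≡ a * c + b * suc d
          take-b = solve-∀

  countFin-punchIn : ∀ {n} (z : Fin (suc n)) (p : Fin (suc n) → Bool) →
                     countFin p ≡ indicator (p z) + countFin (p ∘ punchIn z)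
  countFin-punchIn z p = begin
    countFin p                                       ≡⟨ countFin≡sum p ⟩
    sum (indicator ∘ p)                              ≡⟨ sum-remove (indicator ∘ p) ⟩
    indicator (p z) + sum (indicator ∘ p ∘ punchIn z) ≡⟨ cong (_ +_) (countFin≡sum (p ∘ punchIn z)) ⟨
    indicator (p z) + countFin (p ∘ punchIn z)        ∎
    where open ≡-Reasoning

  sum-codegree : ∀ {m n} (R : Fin m → Fin n → Bool) (z : Fin n) {T} →
                 (∀ x → countFin (R x) ≡ T) →
                 sum (λ w → countFin (λ x → R x z ∧ R x w)) ≡ T * countFin (λ x → R x z)
  sum-codegree R z {T} rows = begin
    sum (λ w → countFin (λ x → R x z ∧ R x w))           ≡⟨ sum-cong-≗ (λ w → countFin≡sum (λ x → R x z ∧ R x w)) ⟩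
    sum (λ w → sum (λ x → indicator (R x z ∧ R x w)))   ≡⟨ ∑-comm (λ x w → indicator (R x z ∧ R x w)) ⟨
    sum (λ x → sum (λ w → indicator (R x z ∧ R x w)))   ≡⟨ sum-cong-≗ (λ x → countFin≡sum (λ w → R x z ∧ R x w)) ⟨
    sum (λ x → countFin (λ w → R x z ∧ R x w))           ≡⟨ sum-cong-≗ row ⟩
    sum (λ x → if R x z then T else 0)                  ≡⟨ sum-if (λ x → R x z) T 0 ⟩
    T * countFin (λ x → R x z) + 0                      ≡⟨ +-identityʳ _ ⟩
    T * countFin (λ x → R x z)                          ∎
    where
    open ≡-Reasoning
    row : ∀ x → countFin (λ w → R x z ∧ R x w) ≡ (if R x z then T else 0)
    row x = trans (countFin-∧ (R x z) (R x)) (cong (λ t → if R x z then t else 0) (rows x))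

  sum-around-vertex : ∀ {n} (z : Fin n) (p : Fin n → Bool) (c : Fin n → ℕ) {S a b} →
               p z ≡ false → c z ≡ S → (∀ w → w ≢ z → c w ≡ (if p w then a else b)) →
               sum c ≡ S + a * countFin p + b * (n ∸ countFin p ∸ 1)
  sum-around-vertex {suc n} z p c {S} {a} {b} pz≡false cz≡S c-elsewhere = begin
    sum c                                               ≡⟨ sum-remove c ⟩
    c z + sum (c ∘ punchIn z)                           ≡⟨ cong₂ _+_ cz≡S (sum-cong-≗ λ i → c-elsewhere _ (punchInᵢ≢i z i)) ⟩
    S + sum (λ i → if q i then a else b)                ≡⟨ cong (S +_) (sum-if q a b) ⟩
    S + (a * countFin q + b * countFin (not ∘ q))       ≡⟨ sym (+-assoc S _ _) ⟩
    S + a * countFin q + b * countFin (not ∘ q)         ≡⟨ cong₂ (λ k l → S + a * k + b * l) q≡p not-q ⟩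
    S + a * countFin p + b * (suc n ∸ countFin p ∸ 1)   ∎
    where
    open ≡-Reasoning
    q : Fin n → Bool
    q = p ∘ punchIn z
    q≡p : countFin q ≡ countFin p
    q≡p = sym (trans (countFin-punchIn z p) (cong (λ t → indicator t + countFin q) pz≡false))
    not-q : countFin (not ∘ q) ≡ suc n ∸ countFin p ∸ 1
    not-q = begin
      countFin (not ∘ q)                              ≡⟨ m+n∸m≡n (countFin q) _ ⟨
      countFin q + countFin (not ∘ q) ∸ countFin q    ≡⟨ cong (_∸ countFin q) (countFin+countFin-not q) ⟩
      suc n ∸ (1 + countFin q)                        ≡⟨ cong (suc n ∸_) (+-comm 1 (countFin q)) ⟩
      suc n ∸ (countFin q + 1)                        ≡⟨ ∸-+-assoc (suc n) (countFin q) 1 ⟨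
      suc n ∸ countFin q ∸ 1                          ≡⟨ cong (λ k → suc n ∸ k ∸ 1) q≡p ⟩
      suc n ∸ countFin p ∸ 1                          ∎

  -- Counting the pairs (x, w) with x R z and x R w in two ways, for a vertex z of valency k.
  codegree-count : ∀ {m n k} (R : Fin m → Fin n → Bool) (adj : Fin n → Fin n → Bool) (z : Fin n) {S T a b} →
                   adj z z ≡ false → countFin (adj z) ≡ k →
                   (∀ x → countFin (R x) ≡ T) → countFin (λ x → R x z) ≡ S →
                   (∀ w → w ≢ z → countFin (λ x → R x z ∧ R x w) ≡ (if adj z w then a else b)) →
                   S + a * k + b * (n ∸ k ∸ 1) ≡ T * S
  codegree-count {n = n} {k} R adj z {S} {T} {a} {b} loopless valency rows column codegree = begin
    S + a * k + b * (n ∸ k ∸ 1)                 ≡⟨ cong (λ l → S + a * l + b * (n ∸ l ∸ 1)) valency ⟨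
    S + a * countFin (adj z) + b * (n ∸ countFin (adj z) ∸ 1)
      ≡⟨ sum-around-vertex z (adj z) (λ w → countFin (λ x → R x z ∧ R x w)) loopless diagonal codegree ⟨
    sum (λ w → countFin (λ x → R x z ∧ R x w))  ≡⟨ sum-codegree R z rows ⟩
    T * countFin (λ x → R x z)                  ≡⟨ cong (T *_) column ⟩
    T * S                                       ∎
    where
    open ≡-Reasoning
    diagonal : countFin (λ x → R x z ∧ R x z) ≡ S
    diagonal = trans (countFin-cong (λ x → ∧-idem (R x z))) column

module Type323 where
  open Counting
  open import Data.Nat using (_+_; _*_)
  open import Data.Nat.Properties using (*-comm; +-identityʳ)
  open import Function using (_∘_)
  open import Data.Fin using (Fin; suc; _≟_)
  open import Data.Fin.Patterns
  open import Data.Bool using (Bool; false; _∧_; if_then_else_)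
  open import Data.Bool.Properties using (∧-idem; ∧-zeroʳ)
  open import Data.Sum using (_⊎_; inj₁; inj₂; [_,_]′)
  open import Data.Product using (proj₁; proj₂)
  open import Relation.Nullary using (yes; no; contradiction)
  open import Relation.Binary.PropositionalEquality

  data Side : Set where
    left right : Side

  side : ∀ {n₁ n₂} → Point n₁ n₂ → Side
  side (inj₁ _) = left
  side (inj₂ _) = right

  block : Idx → Side × Side
  block 0F = left , left
  block 1F = left , left
  block 2F = left , left
  block 3F = right , right
  block 4F = right , right
  block 5F = right , right
  block 6F = left , right
  block 7F = left , right
  block 8F = right , left
  block 9F = right , left

  -- Coordinates of S σ₁ + a σ₂ + b σ₃ and of S σ₄ + a σ₅ + b σ₆ in the basis σ₁, …, σ₁₀.
  coeffs₁₂₃ : ℕ → ℕ → ℕ → Idx → ℕ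
  coeffs₁₂₃ S a b 0F = S
  coeffs₁₂₃ S a b 1F = a
  coeffs₁₂₃ S a b 2F = b
  coeffs₁₂₃ S a b _  = 0

  coeffs₄₅₆ : ℕ → ℕ → ℕ → Idx → ℕ
  coeffs₄₅₆ S a b 3F = S
  coeffs₄₅₆ S a b 4F = a
  coeffs₄₅₆ S a b 5F = b
  coeffs₄₅₆ S a b _  = 0

  coeffs₁₂₃-outside : ∀ {S a b} k → block k ≢ (left , left) → coeffs₁₂₃ S a b k ≡ 0
  coeffs₁₂₃-outside 0F ne = contradiction refl ne
  coeffs₁₂₃-outside 1F ne = contradiction refl ne
  coeffs₁₂₃-outside 2F ne = contradiction refl ne
  coeffs₁₂₃-outside (suc (suc (suc _))) ne = refl

  coeffs₄₅₆-outside : ∀ {S a b} k → block k ≢ (right , right) → coeffs₄₅₆ S a b k ≡ 0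
  coeffs₄₅₆-outside 0F ne = refl
  coeffs₄₅₆-outside 1F ne = refl
  coeffs₄₅₆-outside 2F ne = refl
  coeffs₄₅₆-outside 3F ne = contradiction refl ne
  coeffs₄₅₆-outside 4F ne = contradiction refl ne
  coeffs₄₅₆-outside 5F ne = contradiction refl ne
  coeffs₄₅₆-outside (suc (suc (suc (suc (suc (suc _)))))) ne = refl

  coeffs₁₂₃-off-diagonal : ∀ {S a b} i → i ≡ σ₂ ⊎ i ≡ σ₃ → coeffs₁₂₃ S a b i ≡ (if i == σ₂ then a else b)
  coeffs₁₂₃-off-diagonal _ (inj₁ refl) = refl
  coeffs₁₂₃-off-diagonal _ (inj₂ refl) = refl

  coeffs₄₅₆-off-diagonal : ∀ {S a b} i → i ≡ σ₅ ⊎ i ≡ σ₆ → coeffs₄₅₆ S a b i ≡ (if i == σ₅ then a else b)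
  coeffs₄₅₆-off-diagonal _ (inj₁ refl) = refl
  coeffs₄₅₆-off-diagonal _ (inj₂ refl) = refl

  countX-false : ∀ {n₁ n₂} {p : Point n₁ n₂ → Bool} → (∀ y → p y ≡ false) → countX p ≡ 0
  countX-false p≗false = cong₂ _+_ (countFin-false (p≗false ∘ inj₁)) (countFin-false (p≗false ∘ inj₂))

  module Configuration {n₁ n₂} {col : Point n₁ n₂ → Point n₁ n₂ → Idx}
    (cc : IsCoherentConfiguration col) (type : IsType323 col)
    {S₁ S₂ a₁ b₁ a₂ b₂ : ℕ} (params : HasParams col S₁ S₂ a₁ b₁ a₂ b₂) where

    open IsCoherentConfiguration cc using (nonempty; p; intersection)
    open IsType323 type
    open HasParams params

    block-col : ∀ x y → block (col x y) ≡ (side x , side y)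
    block-col (inj₁ a) (inj₁ b) with a ≟ b
    ... | yes refl = cong block (diag₁ a)
    ... | no a≢b   = [ cong block , cong block ]′ (off₁ a b a≢b)
    block-col (inj₂ z) (inj₂ w) with z ≟ w
    ... | yes refl = cong block (diag₂ z)
    ... | no z≢w   = [ cong block , cong block ]′ (off₂ z w z≢w)
    block-col (inj₁ a) (inj₂ w) = [ cong block ∘ proj₁ , cong block ∘ proj₁ ]′ (mixed a w)
    block-col (inj₂ w) (inj₁ a) = [ cong block ∘ proj₂ , cong block ∘ proj₂ ]′ (mixed a w)

    ==-outside-block : ∀ {x y} j → block j ≢ (side x , side y) → (col x y == j) ≡ false
    ==-outside-block {x} {y} j ne with col x y ≟ j
    ... | yes refl = contradiction (block-col x y) ne
    ... | no _     = refl

    σ₉-transpose : ∀ a w → (col (inj₂ w) (inj₁ a) == σ₉) ≡ in₇ col a w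
    σ₉-transpose a w with mixed a w
    ... | inj₁ (e₇ , e₉)  rewrite e₇ | e₉  = refl
    ... | inj₂ (e₈ , e₁₀) rewrite e₈ | e₁₀ = refl

    codegree₁ : Fin n₁ → Fin n₁ → ℕ
    codegree₁ a b = countFin (λ w → in₇ col a w ∧ in₇ col b w)

    codegree₂ : Fin n₂ → Fin n₂ → ℕ
    codegree₂ z w = countFin (λ x → in₇ col x z ∧ in₇ col x w)

    codegree₁-colour : ∀ a b → codegree₁ a b ≡ coeffs₁₂₃ S₂ a₂ b₂ (col (inj₁ a) (inj₁ b))
    codegree₁-colour a b with a ≟ b
    ... | yes refl rewrite diag₁ a = trans (countFin-cong (λ w → ∧-idem (in₇ col a w))) (S₂-def a)
    ... | no a≢b with off₁ a b a≢b
    ...   | inj₁ e rewrite e = a₂-def a b e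
    ...   | inj₂ e rewrite e = b₂-def a b e

    codegree₂-colour : ∀ z w → codegree₂ z w ≡ coeffs₄₅₆ S₁ a₁ b₁ (col (inj₂ z) (inj₂ w))
    codegree₂-colour z w with z ≟ w
    ... | yes refl rewrite diag₂ z = trans (countFin-cong (λ x → ∧-idem (in₇ col x z))) (S₁-def z)
    ... | no z≢w with off₂ z w z≢w
    ...   | inj₁ e rewrite e = a₁-def z w e
    ...   | inj₂ e rewrite e = b₁-def z w e

    path-outside-blocks : ∀ x y z i j → block i ≢ (side x , side y) ⊎ block j ≢ (side y , side z) →
                          ((col x y == i) ∧ (col y z == j)) ≡ false
    path-outside-blocks x y z i j (inj₁ ne) = cong (_∧ (col y z == j)) (==-outside-block i ne)
    path-outside-blocks x y z i j (inj₂ ne) =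
      trans (cong ((col x y == i) ∧_) (==-outside-block j ne)) (∧-zeroʳ (col x y == i))

    coeffs-outside-X₁ : ∀ x z → (side x , side z) ≢ (left , left) → coeffs₁₂₃ S₂ a₂ b₂ (col x z) ≡ 0
    coeffs-outside-X₁ x z ne = coeffs₁₂₃-outside (col x z) (ne ∘ trans (sym (block-col x z)))

    count₇₉ : ∀ x z → countX (λ y → (col x y == σ₇) ∧ (col y z == σ₉)) ≡ coeffs₁₂₃ S₂ a₂ b₂ (col x z)
    count₇₉ (inj₁ a) (inj₁ b) = trans
      (cong₂ _+_ (countFin-false λ c → path-outside-blocks (inj₁ a) (inj₁ c) (inj₁ b) σ₇ σ₉ (inj₁ λ ()))
                 (countFin-cong λ w → cong (in₇ col a w ∧_) (σ₉-transpose b w)))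
      (codegree₁-colour a b)
    count₇₉ x@(inj₁ _) z@(inj₂ _) =
      trans (countX-false λ y → path-outside-blocks x y z σ₇ σ₉ (inj₂ λ ())) (sym (coeffs-outside-X₁ x z λ ()))
    count₇₉ x@(inj₂ _) z =
      trans (countX-false λ y → path-outside-blocks x y z σ₇ σ₉ (inj₁ λ ())) (sym (coeffs-outside-X₁ x z λ ()))

    coeffs-outside-X₂ : ∀ x z → (side x , side z) ≢ (right , right) → coeffs₄₅₆ S₁ a₁ b₁ (col x z) ≡ 0
    coeffs-outside-X₂ x z ne = coeffs₄₅₆-outside (col x z) (ne ∘ trans (sym (block-col x z)))

    count₉₇ : ∀ x z → countX (λ y → (col x y == σ₉) ∧ (col y z == σ₇)) ≡ coeffs₄₅₆ S₁ a₁ b₁ (col x z)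
    count₉₇ (inj₂ z) (inj₂ w) = trans
      (cong₂ _+_ (countFin-cong λ c → cong (_∧ in₇ col c w) (σ₉-transpose c z))
                 (countFin-false λ v → path-outside-blocks (inj₂ z) (inj₂ v) (inj₂ w) σ₉ σ₇ (inj₁ λ ())))
      (trans (+-identityʳ (codegree₂ z w)) (codegree₂-colour z w))
    count₉₇ x@(inj₁ _) z =
      trans (countX-false λ y → path-outside-blocks x y z σ₉ σ₇ (inj₁ λ ())) (sym (coeffs-outside-X₂ x z λ ()))
    count₉₇ x@(inj₂ _) z@(inj₁ _) =
      trans (countX-false λ y → path-outside-blocks x y z σ₉ σ₇ (inj₂ λ ())) (sym (coeffs-outside-X₂ x z λ ()))

    p₇₉ : ∀ k → p σ₇ σ₉ k ≡ coeffs₁₂₃ S₂ a₂ b₂ k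
    p₇₉ k with nonempty k
    ... | x , z , refl = trans (sym (intersection σ₇ σ₉ (col x z) x z refl)) (count₇₉ x z)

    p₉₇ : ∀ k → p σ₉ σ₇ k ≡ coeffs₄₅₆ S₁ a₁ b₁ k
    p₉₇ k with nonempty k
    ... | x , z , refl = trans (sym (intersection σ₉ σ₇ (col x z) x z refl)) (count₉₇ x z)

    point₁ : Fin n₁
    point₁ with nonempty σ₁
    ... | inj₁ a , _ , _ = a
    ... | x@(inj₂ _) , y , e = contradiction (trans (sym (cong block e)) (block-col x y)) λ ()

    point₂ : Fin n₂
    point₂ with nonempty σ₄
    ... | inj₂ z , _ , _ = z
    ... | x@(inj₁ _) , y , e = contradiction (trans (sym (cong block e)) (block-col x y)) λ ()

    valency-equation₁ : ∀ {k₁ λ₁ μ₁} → IsSRG n₁ k₁ λ₁ μ₁ (adj₁ col σ₂) →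
                        S₂ + a₂ * k₁ + b₂ * (n₁ ∸ k₁ ∸ 1) ≡ S₁ * S₂
    valency-equation₁ srg = codegree-count (λ w a → in₇ col a w) (adj₁ col σ₂) point₁
      (IsSRG.irrefl srg point₁) (IsSRG.regular srg point₁) S₁-def (S₂-def point₁)
      λ b b≢z → trans (codegree₁-colour point₁ b) (coeffs₁₂₃-off-diagonal _ (off₁ point₁ b (≢-sym b≢z)))

    valency-equation₂ : ∀ {k₂ λ₂ μ₂} → IsSRG n₂ k₂ λ₂ μ₂ (adj₂ col σ₅) →
                        S₁ + a₁ * k₂ + b₁ * (n₂ ∸ k₂ ∸ 1) ≡ S₁ * S₂
    valency-equation₂ srg = trans (codegree-count (in₇ col) (adj₂ col σ₅) point₂
      (IsSRG.irrefl srg point₂) (IsSRG.regular srg point₂) S₂-def (S₁-def point₂)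
      λ w w≢z → trans (codegree₂-colour point₂ w) (coeffs₄₅₆-off-diagonal _ (off₂ point₂ w (≢-sym w≢z))))
      (*-comm S₂ S₁)

module CharacterSums {c ℓ : Level} (R : CommutativeRing c ℓ) where
  open CommutativeRing R renaming (Carrier to K) hiding (zero)
  open LinAlg R
  open Type323 using (coeffs₁₂₃; coeffs₄₅₆)
  open import Function using (_∘_)
  open import Data.Nat using (zero; suc)
  open import Data.Fin using (Fin; zero; suc)
  import Relation.Binary.PropositionalEquality as ≡
  open import Algebra.Properties.Semiring.Sum semiring
    using (sum-cong-≋; sum-cong-≗; ∑-comm; *-distribˡ-sum; sum-replicate-zero) renaming (sum to ∑)
  open import Algebra.Properties.Ring ring using (-‿distribʳ-*)
  open import Algebra.Properties.AbelianGroup +-abelianGroup using (⁻¹-∙-comm)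
  open import Relation.Binary.Reasoning.Setoid setoid

  sum≡∑ : ∀ {n} (f : Vec n) → sum f ≡.≡ ∑ f
  sum≡∑ {zero}  f = ≡.refl
  sum≡∑ {suc n} f = ≡.cong (f zero +_) (sum≡∑ (f ∘ suc))

  sum-cong : ∀ {n} {f g : Vec n} → (∀ i → f i ≈ g i) → sum f ≈ sum g
  sum-cong {f = f} {g} f≈g = begin
    sum f ≡⟨ sum≡∑ f ⟩
    ∑ f   ≈⟨ sum-cong-≋ f≈g ⟩
    ∑ g   ≡⟨ sum≡∑ g ⟨
    sum g ∎

  sum-zeroˡ : ∀ {n} (f : Vec n) → sum (λ i → 0# * f i) ≈ 0#
  sum-zeroˡ {n} f = begin
    sum (λ i → 0# * f i) ≈⟨ sum-cong (λ i → zeroˡ (f i)) ⟩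
    sum {n} (λ _ → 0#)   ≡⟨ sum≡∑ {n} (λ _ → 0#) ⟩
    ∑ {n} (λ _ → 0#)     ≈⟨ sum-replicate-zero n ⟩
    0#                   ∎

  *-distribˡ-sum′ : ∀ {n} a (f : Vec n) → a * sum f ≈ sum (λ i → a * f i)
  *-distribˡ-sum′ a f = begin
    a * sum f            ≡⟨ ≡.cong (a *_) (sum≡∑ f) ⟩
    a * ∑ f              ≈⟨ *-distribˡ-sum a f ⟩
    ∑ (λ i → a * f i)    ≡⟨ sum≡∑ (λ i → a * f i) ⟨
    sum (λ i → a * f i)  ∎

  sum-comm : ∀ {m n} (f : Fin m → Fin n → K) → sum (λ i → sum (f i)) ≈ sum (λ j → sum (λ i → f i j))
  sum-comm f = begin
    sum (λ i → sum (f i))           ≡⟨ nested f ⟩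
    ∑ (λ i → ∑ (f i))               ≈⟨ ∑-comm f ⟩
    ∑ (λ j → ∑ (λ i → f i j))       ≡⟨ nested (λ j i → f i j) ⟨
    sum (λ j → sum (λ i → f i j))   ∎
    where
    nested : ∀ {m n} (g : Fin m → Fin n → K) → sum (λ i → sum (g i)) ≡.≡ ∑ (λ i → ∑ (g i))
    nested g = ≡.trans (sum≡∑ (λ i → sum (g i))) (sum-cong-≗ (λ i → sum≡∑ (g i)))

  trace-⊗-comm : ∀ {n} (A B : Mat n) → trace (A ⊗ B) ≈ trace (B ⊗ A)
  trace-⊗-comm A B = trans (sum-comm (λ i k → A i k * B k i))
                           (sum-cong λ k → sum-cong λ i → *-comm (A i k) (B k i))

  module _ {n₁ n₂ : ℕ} {col : Point n₁ n₂ → Point n₁ n₂ → Idx} (cc : IsCoherentConfiguration col) where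
    open IsCoherentConfiguration cc using (p)

    trace-product : ∀ {d} {ρ : Idx → Mat d} → IsRepresentation cc ρ →
                    ∀ i j → trace (ρ i ⊗ ρ j) ≈ sum (λ k → ι (p i j k) * trace (ρ k))
    trace-product {ρ = ρ} (multiplicative , _) i j = begin
      trace (ρ i ⊗ ρ j)                                  ≈⟨ sum-cong (λ x → multiplicative i j x x) ⟩
      sum (λ x → sum (λ k → ι (p i j k) * ρ k x x))      ≈⟨ sum-comm (λ x k → ι (p i j k) * ρ k x x) ⟩
      sum (λ k → sum (λ x → ι (p i j k) * ρ k x x))      ≈⟨ sum-cong (λ k → *-distribˡ-sum′ (ι (p i j k)) (λ x → ρ k x x)) ⟨
      sum (λ k → ι (p i j k) * trace (ρ k))              ∎

    character-comm : ∀ {χ} → IsIrreducibleCharacter cc χ →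
                     ∀ i j → sum (λ k → ι (p i j k) * χ k) ≈ sum (λ k → ι (p j i k) * χ k)
    character-comm {χ} (_ , ρ , representation , _ , χ≈trace) i j = begin
      sum (λ k → ι (p i j k) * χ k)          ≈⟨ in-traces i j ⟩
      sum (λ k → ι (p i j k) * trace (ρ k))  ≈⟨ trace-product {ρ = ρ} representation i j ⟨
      trace (ρ i ⊗ ρ j)                      ≈⟨ trace-⊗-comm (ρ i) (ρ j) ⟩
      trace (ρ j ⊗ ρ i)                      ≈⟨ trace-product {ρ = ρ} representation j i ⟩
      sum (λ k → ι (p j i k) * trace (ρ k))  ≈⟨ in-traces j i ⟨
      sum (λ k → ι (p j i k) * χ k)          ∎
      where
      in-traces : ∀ i j → sum (λ k → ι (p i j k) * χ k) ≈ sum (λ k → ι (p i j k) * trace (ρ k))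
      in-traces i j = sum-cong (λ k → *-congˡ {ι (p i j k)} (χ≈trace k))

  +-assoc-0# : ∀ x y z → x + (y + (z + 0#)) ≈ x + y + z
  +-assoc-0# x y z = trans (+-congˡ (+-congˡ (+-identityʳ z))) (sym (+-assoc x y z))

  sum-coeffs₁₂₃ : ∀ S a b (χ : Idx → K) →
                  sum (λ k → ι (coeffs₁₂₃ S a b k) * χ k) ≈ ι S * χ σ₁ + ι a * χ σ₂ + ι b * χ σ₃
  sum-coeffs₁₂₃ S a b χ = begin
    ι S * χ σ₁ + (ι a * χ σ₂ + (ι b * χ σ₃ + sum (λ k → 0# * χ (suc (suc (suc k))))))
      ≈⟨ +-congˡ (+-congˡ (+-congˡ (sum-zeroˡ {7} (λ k → χ (suc (suc (suc k))))))) ⟩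
    ι S * χ σ₁ + (ι a * χ σ₂ + (ι b * χ σ₃ + 0#))  ≈⟨ +-assoc-0# _ _ _ ⟩
    ι S * χ σ₁ + ι a * χ σ₂ + ι b * χ σ₃           ∎

  sum-coeffs₄₅₆ : ∀ S a b (χ : Idx → K) →
                  sum (λ k → ι (coeffs₄₅₆ S a b k) * χ k) ≈ ι S * χ σ₄ + ι a * χ σ₅ + ι b * χ σ₆
  sum-coeffs₄₅₆ S a b χ = begin
    0# * χ σ₁ + (0# * χ σ₂ + (0# * χ σ₃ + (ι S * χ σ₄ + (ι a * χ σ₅ + (ι b * χ σ₆ + sum (λ k → 0# * χ (suc (suc (suc (suc (suc (suc k))))))))))))
      ≈⟨ vanish (vanish (vanish (+-congˡ (+-congˡ (+-congˡ (sum-zeroˡ {4} (λ k → χ (suc (suc (suc (suc (suc (suc k))))))))))))) ⟩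
    ι S * χ σ₄ + (ι a * χ σ₅ + (ι b * χ σ₆ + 0#))  ≈⟨ +-assoc-0# _ _ _ ⟩
    ι S * χ σ₄ + ι a * χ σ₅ + ι b * χ σ₆           ∎
    where
    vanish : ∀ {x y z} → y ≈ z → 0# * x + y ≈ z
    vanish {x} y≈z = trans (+-cong (zeroˡ x) y≈z) (+-identityˡ _)

  weight-at-eigenvalue : ∀ s a b {x y z} t → x ≈ 1# → y ≈ t → z ≈ - 1# + - t →
                         s * x + a * y + b * z ≈ s + a * t + - (b * (t + 1#))
  weight-at-eigenvalue s a b {x} {y} {z} t x≈1 y≈t z≈ = begin
    s * x + a * y + b * z              ≈⟨ +-cong (+-cong (*-congˡ x≈1) (*-congˡ y≈t)) (*-congˡ z≈) ⟩
    s * 1# + a * t + b * (- 1# + - t)  ≈⟨ +-cong (+-congʳ (*-identityʳ s)) (*-congˡ (⁻¹-∙-comm 1# t)) ⟩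
    s + a * t + b * - (1# + t)         ≈⟨ +-congˡ (*-congˡ (-‿cong (+-comm 1# t))) ⟩
    s + a * t + b * - (t + 1#)         ≈⟨ +-congˡ (-‿distribʳ-* b (t + 1#)) ⟨
    s + a * t + - (b * (t + 1#))       ∎

  weight-at-zero : ∀ s a b {x y z} → x ≈ 0# → y ≈ 0# → z ≈ 0# → s * x + a * y + b * z ≈ 0#
  weight-at-zero s a b {x} {y} {z} x≈0 y≈0 z≈0 = begin
    s * x + a * y + b * z     ≈⟨ +-cong (+-cong (*-congˡ x≈0) (*-congˡ y≈0)) (*-congˡ z≈0) ⟩
    s * 0# + a * 0# + b * 0#  ≈⟨ +-cong (+-cong (zeroʳ s) (zeroʳ a)) (zeroʳ b) ⟩
    0# + 0# + 0#              ≈⟨ trans (+-identityʳ _) (+-identityʳ 0#) ⟩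
    0#                        ∎

module CharacterBalance {c ℓ : Level} (R : CommutativeRing c ℓ)
  {n₁ n₂ : ℕ} {col : Point n₁ n₂ → Point n₁ n₂ → Idx}
  (cc : IsCoherentConfiguration col) (type : IsType323 col)
  {S₁ S₂ a₁ b₁ a₂ b₂ : ℕ} (params : HasParams col S₁ S₂ a₁ b₁ a₂ b₂) where

  open CommutativeRing R
  open LinAlg R
  open CharacterSums R
  open Type323 using (coeffs₁₂₃; coeffs₄₅₆)
  open Type323.Configuration cc type params using (p₇₉; p₉₇)
  open IsCoherentConfiguration cc using (p)
  open import Relation.Binary.PropositionalEquality using (cong)
  open import Relation.Binary.Reasoning.Setoid setoid

  character-balance : ∀ {χ} → IsIrreducibleCharacter cc χ →
                      ι S₂ * χ σ₁ + ι a₂ * χ σ₂ + ι b₂ * χ σ₃ ≈ ι S₁ * χ σ₄ + ι a₁ * χ σ₅ + ι b₁ * χ σ₆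
  character-balance {χ} irreducible = begin
    ι S₂ * χ σ₁ + ι a₂ * χ σ₂ + ι b₂ * χ σ₃      ≈⟨ sum-coeffs₁₂₃ S₂ a₂ b₂ χ ⟨
    sum (λ k → ι (coeffs₁₂₃ S₂ a₂ b₂ k) * χ k)  ≈⟨ sum-cong (λ k → *-congʳ {χ k} (reflexive (cong ι (p₇₉ k)))) ⟨
    sum (λ k → ι (p σ₇ σ₉ k) * χ k)             ≈⟨ character-comm cc irreducible σ₇ σ₉ ⟩
    sum (λ k → ι (p σ₉ σ₇ k) * χ k)             ≈⟨ sum-cong (λ k → *-congʳ {χ k} (reflexive (cong ι (p₉₇ k)))) ⟩
    sum (λ k → ι (coeffs₄₅₆ S₁ a₁ b₁ k) * χ k)  ≈⟨ sum-coeffs₄₅₆ S₁ a₁ b₁ χ ⟩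
    ι S₁ * χ σ₄ + ι a₁ * χ σ₅ + ι b₁ * χ σ₆      ∎

mainTheorem4 :
  ∀ {c ℓ : Level} (R : CommutativeRing c ℓ) →
  let open CommutativeRing R renaming (Carrier to K) hiding (zero)
      open LinAlg R
  in IsField → CharZero → AlgClosed →
  ∀ {n₁ n₂ : ℕ} (col : Point n₁ n₂ → Point n₁ n₂ → Idx)
    (cc : IsCoherentConfiguration col) → IsType323 col →
  ∀ {k₁ λ₁ μ₁ k₂ λ₂ μ₂ : ℕ} →
    IsSRG n₁ k₁ λ₁ μ₁ (adj₁ col σ₂) → IsSRG n₂ k₂ λ₂ μ₂ (adj₂ col σ₅) →
  ∀ {S₁ S₂ a₁ b₁ a₂ b₂ : ℕ} → HasParams col S₁ S₂ a₁ b₁ a₂ b₂ →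
  ∀ {r₁ s₁ r₂ s₂ : K} {f₁ g₁ f₂ g₂ : ℕ} →
    SRGEigenvalues (matOf (adj₁ col σ₂)) (ι k₁) r₁ s₁ f₁ g₁ →
    SRGEigenvalues (matOf (adj₂ col σ₅)) (ι k₂) r₂ s₂ f₂ g₂ →
    f₁ ≡ f₂ →
    (∃[ φ ] (IsIrreducibleCharacter cc φ
             × φ σ₁ ≈ 1# × φ σ₄ ≈ 1#
             × φ σ₂ ≈ r₁ × φ σ₃ ≈ - 1# + - r₁
             × φ σ₅ ≈ r₂ × φ σ₆ ≈ - 1# + - r₂)) →
    (∃[ ψ₁ ] (IsIrreducibleCharacter cc ψ₁
             × ψ₁ σ₁ ≈ 1# × ψ₁ σ₂ ≈ s₁ × ψ₁ σ₃ ≈ - 1# + - s₁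
             × ψ₁ σ₄ ≈ 0# × ψ₁ σ₅ ≈ 0# × ψ₁ σ₆ ≈ 0#)) →
    (∃[ ψ₂ ] (IsIrreducibleCharacter cc ψ₂
             × ψ₂ σ₄ ≈ 1# × ψ₂ σ₅ ≈ s₂ × ψ₂ σ₆ ≈ - 1# + - s₂
             × ψ₂ σ₁ ≈ 0# × ψ₂ σ₂ ≈ 0# × ψ₂ σ₃ ≈ 0#)) →
    -- (13)
    (S₁ ℕ.+ a₁ ℕ.* k₂ ℕ.+ b₁ ℕ.* (n₂ ∸ k₂ ∸ 1) ≡ S₁ ℕ.* S₂
     × S₂ ℕ.+ a₂ ℕ.* k₁ ℕ.+ b₂ ℕ.* (n₁ ∸ k₁ ∸ 1) ≡ S₁ ℕ.* S₂)
    -- (14)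
    × (ι S₁ + ι a₁ * r₂ + - (ι b₁ * (r₂ + 1#))
       ≈ ι S₂ + ι a₂ * r₁ + - (ι b₂ * (r₁ + 1#)))
    -- (15)
    × (ι S₁ + ι a₁ * s₂ + - (ι b₁ * (s₂ + 1#))
       ≈ ι S₂ + ι a₂ * s₁ + - (ι b₂ * (s₁ + 1#))
       × ι S₂ + ι a₂ * s₁ + - (ι b₂ * (s₁ + 1#)) ≈ 0#)
-- The field and eigenvalue hypotheses only guarantee that φ, ψ₁ and ψ₂ exist, which is assumed here.
mainTheorem4 R _ _ _ col cc type srg₁ srg₂ {S₁} {S₂} {a₁} {b₁} {a₂} {b₂} params {s₁ = s₁} {s₂ = s₂} _ _ _
  (_ , φ-irreducible , φσ₁ , φσ₄ , φσ₂ , φσ₃ , φσ₅ , φσ₆)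
  (_ , ψ₁-irreducible , ψ₁σ₁ , ψ₁σ₂ , ψ₁σ₃ , ψ₁σ₄ , ψ₁σ₅ , ψ₁σ₆)
  (_ , ψ₂-irreducible , ψ₂σ₄ , ψ₂σ₅ , ψ₂σ₆ , ψ₂σ₁ , ψ₂σ₂ , ψ₂σ₃) =
    (valency-equation₂ srg₂ , valency-equation₁ srg₁)
  , trans (sym (weight-at-eigenvalue _ _ _ _ φσ₄ φσ₅ φσ₆))
          (trans (sym (character-balance φ-irreducible)) (weight-at-eigenvalue _ _ _ _ φσ₁ φσ₂ φσ₃))
  , (trans vanishes₂ (sym vanishes₁) , vanishes₁)
  where
  open CommutativeRing R using (_≈_; _+_; _*_; -_; 0#; 1#; sym; trans)
  open LinAlg R using (ι)
  open CharacterSums R using (weight-at-eigenvalue; weight-at-zero)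
  open Type323.Configuration cc type params using (valency-equation₁; valency-equation₂)
  open CharacterBalance R cc type params

  vanishes₁ : ι S₂ + ι a₂ * s₁ + - (ι b₂ * (s₁ + 1#)) ≈ 0#
  vanishes₁ = trans (sym (weight-at-eigenvalue _ _ _ _ ψ₁σ₁ ψ₁σ₂ ψ₁σ₃))
                    (trans (character-balance ψ₁-irreducible) (weight-at-zero _ _ _ ψ₁σ₄ ψ₁σ₅ ψ₁σ₆))

  vanishes₂ : ι S₁ + ι a₁ * s₂ + - (ι b₁ * (s₂ + 1#)) ≈ 0#
  vanishes₂ = trans (sym (weight-at-eigenvalue _ _ _ _ ψ₂σ₄ ψ₂σ₅ ψ₂σ₆))
                    (trans (sym (character-balance ψ₂-irreducible)) (weight-at-zero _ _ _ ψ₂σ₁ ψ₂σ₂ ψ₂σ₃))
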